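{- Let $D,D'$ be binary relational systems with $D\leq_{\mathrm{End}}D'$. Then (i) the map $\Psi:\mathrm{End}(D')\to\mathrm{End}(D)$, $g\mapsto g|_{V(D)}$, is a monoid isomorphism; (ii) $\mathscr P_D$ is an induced subposet of $\mathscr P_{D'}$ (via $[v]_D\mapsto [v]_{D'}$).
   Context: A binary relational system (binary $I$-system) is a finite set $V$ with a family of relations $A_i\subseteq V^2$, $i\in I$, $I$ finite. A homomorphism between two binary $I$-systems sends $i$-related pairs to $i$-related pairs for each $i$; $\mathrm{End}(D)$ is the monoid of endomorphisms. $D=(V,\{A_i\}_{i\in I})$ is an induced subsystem of $D'=(V',\{A'_i\}_{i\in I'})$ if $I\subseteq I'$, $V\subseteq V'$, $A_i=A'_i\cap V^2$ for $i\in I$ and $A'_i\cap V^2=\emptyset$ for $i\in I'\setminus I$. $D\leq_{\mathrm{End}}D'$ means $D$ is an induced subsystem of $D'$ and $g\mapsto g|_{V(D)}$ defines a bijection $\mathrm{End}(D')\to\mathrm{End}(D)$. Vertices $v,w$ are in the same endomorphism class, $v\sim w$, if there are $f,g\in\mathrm{End}(D)$ with $f(v)=w$, $g(w)=v$; $[v]$ denotes the class. $\mathscr P_D$ is the poset on $V(D)/\!\sim$ with $[v]\preceq[w]$ iff some $f\in\mathrm{End}(D)$ has $f(v)=w$. -}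

module Defs where

open import Data.Nat using (ℕ)
open import Data.Fin using (Fin)
open import Data.Bool using (Bool; true; false)
open import Data.Product using (Σ; ∃; _×_; _,_; proj₁)
open import Function using (_∘_; id)
open import Relation.Binary.PropositionalEquality using (_≡_; _≢_; refl; cong; trans)
open import Relation.Binary.Core using (Rel)
open import Algebra.Bundles.Raw using (RawMonoid)
open import Level using (0ℓ)

-- A binary I-system: vertex set V = Fin n, finite index set I = Fin k,
-- relations A_i ⊆ V² given by their (Bool-valued) characteristic functions.
record BinSys : Set where
  field
    n   : ℕ
    k   : ℕ
    rel : Fin k → Fin n → Fin n → Bool

open BinSys public

Vtx : BinSys → Set
Vtx D = Fin (n D)

IsEndo : (D : BinSys) → (Vtx D → Vtx D) → Set
IsEndo D f = ∀ i u v → rel D i u v ≡ true → rel D i (f u) (f v) ≡ true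

End : BinSys → Set
End D = Σ (Vtx D → Vtx D) (IsEndo D)

_≈E_ : {D : BinSys} → Rel (End D) 0ℓ
f ≈E g = ∀ v → proj₁ f v ≡ proj₁ g v

idE : (D : BinSys) → End D
idE D = id , λ i u v p → p

_∘E_ : {D : BinSys} → End D → End D → End D
(f , pf) ∘E (g , pg) = (f ∘ g) , λ i u v p → pf i (g u) (g v) (pg i u v p)

EndMonoid : BinSys → RawMonoid 0ℓ 0ℓ
EndMonoid D = record
  { Carrier = End D
  ; _≈_     = _≈E_ {D}
  ; _∙_     = _∘E_ {D}
  ; ε       = idE D
  }

-- D is an induced subsystem of D': I ⊆ I' and V ⊆ V' via injections ιI, ιV;
-- A_i = A'_i ∩ V² for i ∈ I, and A'_i ∩ V² = ∅ for i ∈ I' ∖ I.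
record InducedSub (D D' : BinSys) : Set where
  field
    ιV      : Vtx D → Vtx D'
    ιV-inj  : ∀ u v → ιV u ≡ ιV v → u ≡ v
    ιI      : Fin (k D) → Fin (k D')
    ιI-inj  : ∀ i j → ιI i ≡ ιI j → i ≡ j
    rel-in  : ∀ i u v → rel D i u v ≡ rel D' (ιI i) (ιV u) (ιV v)
    rel-out : ∀ i' → (∀ i → ιI i ≢ i') → ∀ u v → rel D' i' (ιV u) (ιV v) ≡ false

open InducedSub public

-- D ≤_End D': D is an induced subsystem of D', and restriction g ↦ g|_V(D)
-- is a well-defined bijection End(D') → End(D).
record EndLe (D D' : BinSys) : Set where
  field
    ind      : InducedSub D D'
    ψ        : End D' → End D
    ψ-restr  : ∀ g v → ιV ind (proj₁ (ψ g) v) ≡ proj₁ g (ιV ind v)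
    ψ-inj    : ∀ g h → ψ g ≈E ψ h → g ≈E h
    ψ-surj   : ∀ f → ∃ λ g → ψ g ≈E f

open EndLe public

-- [v] ⪯ [w] in 𝒫_D (stated on representatives): some endomorphism maps v to w
_⊢_⪯_ : (D : BinSys) → Vtx D → Vtx D → Set
D ⊢ v ⪯ w = ∃ λ (f : End D) → proj₁ f v ≡ w

_⊢_∼_ : (D : BinSys) → Vtx D → Vtx D → Set
D ⊢ v ∼ w = (D ⊢ v ⪯ w) × (D ⊢ w ⪯ v)

{-# OPTIONS --safe #-}
module Submission where

open import Defs
open import Data.Product using (_×_; _,_; proj₁)
open import Data.Product.Function.NonDependent.Propositional using (_×-⇔_)
open import Function using (_∘_; id)
open import Function.Bundles using (_⇔_; mk⇔)
open import Function.Definitions using (Surjective)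
open import Algebra.Morphism.Structures using (module MonoidMorphisms)
open import Relation.Binary.PropositionalEquality using (_≡_; _≗_; refl; sym; trans; cong)

-- Since ι is injective, a map on V(D) is determined by any map on V(D') it
-- restricts; this alone makes restriction a monoid homomorphism.
module Restriction (D D' : BinSys) (ι : Vtx D → Vtx D')
                   (ι-inj : ∀ u v → ι u ≡ ι v → u ≡ v) where

  _Restricts_ : (Vtx D → Vtx D) → (Vtx D' → Vtx D') → Set
  f Restricts g = ∀ v → ι (f v) ≡ g (ι v)

  restriction-unique : ∀ {f f' g g'} → f Restricts g → f' Restricts g' →
                       g ≗ g' → f ≗ f'
  restriction-unique {f} {f'} r r' g≗g' v = ι-inj (f v) (f' v)
    (trans (r v) (trans (g≗g' (ι v)) (sym (r' v))))

  id-Restricts-id : id Restricts id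
  id-Restricts-id v = refl

  ∘-Restricts-∘ : ∀ {f f' g g'} → f Restricts g → f' Restricts g' →
                  (f ∘ f') Restricts (g ∘ g')
  ∘-Restricts-∘ {f} {f'} {g} r r' v = trans (r (f' v)) (cong g (r' v))

module _ {D D' : BinSys} (H : EndLe D D') where
  private
    ι : Vtx D → Vtx D'
    ι = ιV (ind H)

  open Restriction D D' ι (ιV-inj (ind H))
  open MonoidMorphisms (EndMonoid D') (EndMonoid D)

  ψ-isMonoidIsomorphism : IsMonoidIsomorphism (ψ H)
  ψ-isMonoidIsomorphism = record
    { isMonoidMonomorphism = record
      { isMonoidHomomorphism = record
        { isMagmaHomomorphism = record
          { isRelHomomorphism = record { cong = ψ-cong }
          ; homo = ψ-homo
          }
        ; ε-homo = ψ-ε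
        }
      ; injective = ψ-inj H _ _
      }
    ; surjective = ψ-surjective
    }
    where
    ψ-cong : ∀ {g h} → _≈E_ {D'} g h → _≈E_ {D} (ψ H g) (ψ H h)
    ψ-cong {g} {h} = restriction-unique (ψ-restr H g) (ψ-restr H h)

    ψ-homo : ∀ g h → _≈E_ {D} (ψ H (_∘E_ {D'} g h)) (_∘E_ {D} (ψ H g) (ψ H h))
    ψ-homo g h = restriction-unique {g = proj₁ g ∘ proj₁ h}
      (ψ-restr H (_∘E_ {D'} g h))
      (∘-Restricts-∘ {g = proj₁ g} {g' = proj₁ h} (ψ-restr H g) (ψ-restr H h))
      (λ _ → refl)

    ψ-ε : _≈E_ {D} (ψ H (idE D')) (idE D)
    ψ-ε = restriction-unique {g = id}
      (ψ-restr H (idE D')) id-Restricts-id (λ _ → refl)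

    ψ-surjective : Surjective (_≈E_ {D'}) (_≈E_ {D}) (ψ H)
    ψ-surjective f with ψ-surj H f
    ... | g , ψg≈f = g , λ z≈g v → trans (ψ-cong z≈g v) (ψg≈f v)

  ⪯⇔ι⪯ : ∀ v w → (D ⊢ v ⪯ w) ⇔ (D' ⊢ ι v ⪯ ι w)
  ⪯⇔ι⪯ v w = mk⇔ extend restrict
    where
    extend : D ⊢ v ⪯ w → D' ⊢ ι v ⪯ ι w
    extend (f , fv≡w) with ψ-surj H f
    ... | g , ψg≈f = g , trans (sym (ψ-restr H g v))
                               (cong ι (trans (ψg≈f v) fv≡w))

    restrict : D' ⊢ ι v ⪯ ι w → D ⊢ v ⪯ w
    restrict (g , gιv≡ιw) =
      ψ H g , ιV-inj (ind H) _ _ (trans (ψ-restr H g v) gιv≡ιw)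

  ∼⇔ι∼ : ∀ v w → (D ⊢ v ∼ w) ⇔ (D' ⊢ ι v ∼ ι w)
  ∼⇔ι∼ v w = ⪯⇔ι⪯ v w ×-⇔ ⪯⇔ι⪯ w v

lemma5p1 : (D D' : BinSys) → (H : EndLe D D') →
    MonoidMorphisms.IsMonoidIsomorphism (EndMonoid D') (EndMonoid D) (ψ H)
    × ((∀ v w → (D ⊢ v ∼ w) ⇔ (D' ⊢ ιV (ind H) v ∼ ιV (ind H) w))
    × (∀ v w → (D ⊢ v ⪯ w) ⇔ (D' ⊢ ιV (ind H) v ⪯ ιV (ind H) w)))
lemma5p1 D D' H = ψ-isMonoidIsomorphism H , ∼⇔ι∼ H , ⪯⇔ι⪯ H
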